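{- Let $k\geq 4$ be an integer. If $G$ is a (simple) graph on $3k$ vertices with $e(G)\leq 3k-3$ edges, then $G$ is $k$-partite with parts of size $3$, i.e., $V(G)$ can be partitioned into $k$ independent sets each of size $3$.
   Context: All graphs are finite and simple; $e(G)$ denotes the number of edges of $G$. -}

module Defs where

open import Data.Nat using (ℕ; _<_)
open import Data.Fin using (Fin; toℕ)
open import Data.Fin.Properties using (_≟_)
open import Data.List using (List; filter; length; allFin; cartesianProduct)
open import Data.Product using (_×_; _,_; proj₁; proj₂)
open import Relation.Binary.PropositionalEquality using (_≡_)
open import Relation.Nullary using (¬_; Dec)
open import Relation.Nullary.Decidable using (_×-dec_)
open import Relation.Unary using (Decidable)
import Data.Nat.Properties as ℕP

record Graph (n : ℕ) : Set₁ where
  field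
    Adj       : Fin n → Fin n → Set
    adj?      : (i j : Fin n) → Dec (Adj i j)
    sym       : ∀ {i j} → Adj i j → Adj j i
    irrefl    : ∀ {i} → ¬ Adj i i

open Graph public

edgeCount : ∀ {n} → Graph n → ℕ
edgeCount {n} G =
  length (filter (λ p → (toℕ (proj₁ p) ℕP.<? toℕ (proj₂ p)) ×-dec adj? G (proj₁ p) (proj₂ p))
                 (cartesianProduct (allFin n) (allFin n)))

classSize : ∀ {n k} → (Fin n → Fin k) → Fin k → ℕ
classSize {n} c a = length (filter (λ v → c v ≟ a) (allFin n))

PartitionIntoIndependentTriples : ∀ {n} → Graph n → (k : ℕ) → Set
PartitionIntoIndependentTriples {n} G k =
  Data.Product.Σ (Fin n → Fin k) λ c →
    ((a : Fin k) → classSize c a ≡ 3) ×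
    (∀ u v → Adj G u v → ¬ (c u ≡ c v))

module Submission where

-- Induction on the number M of triples against the edge budget f M = 3M − 3, lowered to 0, 2, 5
-- for M = 1, 2, 3 (edgeBudget).  Take a vertex v of maximum degree Δ, a non-neighbour x ≠ v of
-- maximum degree d among the non-neighbours of v, and a common non-neighbour y of v and x, which
-- exists because Δ + d ≤ e ≤ 3M − 3.  Deleting the independent triple {v, x, y} removes at least
-- Δ + d edges.  Summing degrees over the closed neighbourhood of v and over its complement gives
-- 2e ≤ Δ + Δ² + (3M − 1 − Δ) d, which forces e − Δ − d ≤ f (M − 1): for M ≥ 5 either Δ + d ≥ 3,
-- or Δ ≤ 2 and few edges are left; for M ≤ 4 it is a finite check.

open import Defs
open import Data.Nat using (ℕ; suc; _+_; _*_; _∸_; _≤_; _<_; _≤?_; _<?_; z≤n; s≤s; s≤s⁻¹)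
open import Data.Nat.Properties
  using ( ≤-refl; ≤-reflexive; ≤-trans; <⇒≱; ≮⇒≥; ≰⇒>; ≤∧≢⇒<; <-irrefl; <-asym
        ; m≤m+n; m≤n+m; n≤1+n; m≤n⇒m≤1+n; m+n∸m≡n; +-suc; +-comm; +-assoc; +-identityʳ
        ; *-suc; *-zeroʳ; *-identityʳ; +-mono-≤; +-monoˡ-≤; +-monoʳ-≤; +-mono-<
        ; +-cancelˡ-≡; +-cancelˡ-≤; +-cancelʳ-≤; allUpTo?; +-commutativeSemigroup
        ; module ≤-Reasoning )
open import Data.Nat.ListAction using (sum)
open import Data.Nat.ListAction.Properties using (sum-↭)
open import Data.Nat.Tactic.RingSolver using (solve-∀)
open import Algebra.Properties.CommutativeSemigroup +-commutativeSemigroup using (x∙yz≈y∙xz; interchange)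
open import Data.Fin as Fin using (Fin; toℕ)
open import Data.Fin.Properties using (_≟_; toℕ-injective; suc-injective; 0≢1+n)
open import Data.List using (List; []; _∷_; _++_; length; filter; map; allFin; cartesianProduct)
open import Data.List.Properties using (filter-++; length-++; filter-all; filter-none; filter-some; length-tabulate)
open import Data.List.Extrema.Nat using (argmax; argmax-sel; f[⊥]≤f[argmax]; f[xs]≤f[argmax])
open import Data.List.Membership.Propositional using (_∈_)
open import Data.List.Membership.Propositional.Properties
  using (∈-∃++; ∈-++⁺ʳ; ∈-++⁻; ∈-filter⁻; ∈-allFin)
import Data.List.Membership.DecPropositional as DecMembership
open import Data.List.Relation.Unary.Any as Any using (here; there)
open import Data.List.Relation.Unary.All as All using ([]; _∷_)
open import Data.List.Relation.Unary.AllPairs as AllPairs using (AllPairs; []; _∷_)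
open import Data.List.Relation.Unary.Unique.Propositional using (Unique)
open import Data.List.Relation.Unary.Unique.Propositional.Properties using (allFin⁺)
open import Data.List.Relation.Binary.Disjoint.Propositional using (Disjoint)
open import Data.List.Relation.Binary.Permutation.Propositional as ↭
  using (_↭_; prep; swap; ↭-sym; ↭-trans; ↭⇒↭ₛ)
open import Data.List.Relation.Binary.Permutation.Propositional.Properties
  using (↭-length; filter-↭; map⁺; shift; ∈-resp-↭)
import Data.List.Relation.Binary.Permutation.Setoid.Properties as ↭ₛ
open import Data.Product using (Σ-syntax; ∃-syntax; _×_; _,_; proj₁; proj₂)
open import Data.Sum using (inj₁; inj₂)
open import Data.Unit using (tt)
open import Function using (id; _∘_)
open import Relation.Nullary using (¬_; Dec; yes; no; contradiction)
open import Relation.Nullary.Decidable using (_×-dec_; _→-dec_; toWitness)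
open import Relation.Unary using (Decidable; ∁)
open import Relation.Unary.Properties using (∁?; _∩?_)
import Relation.Binary.Definitions as Binary
open import Relation.Binary.PropositionalEquality as ≡ using (_≡_; _≢_; refl; cong; cong₂; subst)

private variable
  A B : Set

count : {P : A → Set} → Decidable P → List A → ℕ
count P? xs = length (filter P? xs)

count-↭ : {P : A → Set} (P? : Decidable P) {xs ys : List A} → xs ↭ ys → count P? xs ≡ count P? ys
count-↭ P? p = ↭-length (filter-↭ P? p)

count-map : {P : A → Set} (P? : Decidable P) (f : B → A) (xs : List B) →
            count P? (map f xs) ≡ count (λ x → P? (f x)) xs
count-map P? f [] = refl
count-map P? f (x ∷ xs) with P? (f x)
... | yes _ = cong suc (count-map P? f xs)
... | no  _ = count-map P? f xs

count-++ : {P : A → Set} (P? : Decidable P) (xs ys : List A) → count P? (xs ++ ys) ≡ count P? xs + count P? ys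
count-++ P? xs ys = ≡.trans (cong length (filter-++ P? xs ys)) (length-++ (filter P? xs))

count-all : {P : A → Set} (P? : Decidable P) (xs : List A) → (∀ {x} → x ∈ xs → P x) →
            count P? xs ≡ length xs
count-all P? xs all = cong length (filter-all P? (All.tabulate all))

count-none : {P : A → Set} (P? : Decidable P) (xs : List A) → (∀ {x} → x ∈ xs → ¬ P x) →
             count P? xs ≡ 0
count-none P? xs none = cong length (filter-none P? (All.tabulate none))

length≡count+count∁ : {P : A → Set} (P? : Decidable P) (xs : List A) →
                      length xs ≡ count P? xs + count (∁? P?) xs
length≡count+count∁ P? [] = refl
length≡count+count∁ P? (x ∷ xs) with P? x
... | yes _ = cong suc (length≡count+count∁ P? xs)
... | no  _ = ≡.trans (cong suc (length≡count+count∁ P? xs)) (≡.sym (+-suc _ _))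

count≡count∩+count∁∩ : {P Q : A → Set} (P? : Decidable P) (Q? : Decidable Q) (xs : List A) →
                       count P? xs ≡ count (Q? ∩? P?) xs + count (∁? Q? ∩? P?) xs
count≡count∩+count∁∩ P? Q? [] = refl
count≡count∩+count∁∩ P? Q? (x ∷ xs) with Q? x | P? x
... | yes _ | yes _ = cong suc (count≡count∩+count∁∩ P? Q? xs)
... | no  _ | yes _ = ≡.trans (cong suc (count≡count∩+count∁∩ P? Q? xs)) (≡.sym (+-suc _ _))
... | yes _ | no  _ = count≡count∩+count∁∩ P? Q? xs
... | no  _ | no  _ = count≡count∩+count∁∩ P? Q? xs

count-cong-∈ : {P Q : A → Set} (P? : Decidable P) (Q? : Decidable Q) (xs : List A) →
               (∀ {x} → x ∈ xs → P x → Q x) → (∀ {x} → x ∈ xs → Q x → P x) →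
               count P? xs ≡ count Q? xs
count-cong-∈ P? Q? [] _ _ = refl
count-cong-∈ P? Q? (x ∷ xs) P⇒Q Q⇒P with P? x | Q? x
... | yes _  | yes _  = cong suc (count-cong-∈ P? Q? xs (P⇒Q ∘ there) (Q⇒P ∘ there))
... | yes px | no ¬qx = contradiction (P⇒Q (here refl) px) ¬qx
... | no ¬px | yes qx = contradiction (Q⇒P (here refl) qx) ¬px
... | no  _  | no  _  = count-cong-∈ P? Q? xs (P⇒Q ∘ there) (Q⇒P ∘ there)

count-filter-≤ : {P Q : A → Set} (P? : Decidable P) (Q? : Decidable Q) (xs : List A) →
                 count P? (filter Q? xs) ≤ count P? xs
count-filter-≤ P? Q? [] = z≤n
count-filter-≤ P? Q? (x ∷ xs) with Q? x
... | yes _ with P? x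
...   | yes _ = s≤s (count-filter-≤ P? Q? xs)
...   | no  _ = count-filter-≤ P? Q? xs
count-filter-≤ P? Q? (x ∷ xs) | no _ with P? x
...   | yes _ = m≤n⇒m≤1+n (count-filter-≤ P? Q? xs)
...   | no  _ = count-filter-≤ P? Q? xs

sum-map-↭ : (g : A → ℕ) {xs ys : List A} → xs ↭ ys → sum (map g xs) ≡ sum (map g ys)
sum-map-↭ g p = sum-↭ (map⁺ g p)

sum-map-≤ : (g : A → ℕ) {b : ℕ} (xs : List A) → (∀ {x} → x ∈ xs → g x ≤ b) →
            sum (map g xs) ≤ length xs * b
sum-map-≤ g [] _ = z≤n
sum-map-≤ g (x ∷ xs) g≤b = +-mono-≤ (g≤b (here refl)) (sum-map-≤ g xs (g≤b ∘ there))

sum-map-filter : {P : A → Set} (P? : Decidable P) (g : A → ℕ) (xs : List A) →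
                 sum (map g xs) ≡ sum (map g (filter P? xs)) + sum (map g (filter (∁? P?) xs))
sum-map-filter P? g [] = refl
sum-map-filter P? g (x ∷ xs) with P? x
... | yes _ = ≡.trans (cong (g x +_) (sum-map-filter P? g xs)) (≡.sym (+-assoc (g x) _ _))
... | no  _ = ≡.trans (cong (g x +_) (sum-map-filter P? g xs))
                      (x∙yz≈y∙xz (g x) (sum (map g (filter P? xs))) _)

pairs : {R : A → B → Set} → Binary.Decidable R → List A → List B → ℕ
pairs R? xs ys = sum (map (λ x → count (R? x) ys) xs)

pairs-∷ʳ : {R : A → B → Set} (R? : Binary.Decidable R) (xs : List A) (y : B) (ys : List B) →
           pairs R? xs (y ∷ ys) ≡ count (λ x → R? x y) xs + pairs R? xs ys
pairs-∷ʳ R? [] y ys = refl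
pairs-∷ʳ R? (x ∷ xs) y ys with R? x y
... | yes _ = cong suc (≡.trans (cong (count (R? x) ys +_) (pairs-∷ʳ R? xs y ys))
                                (x∙yz≈y∙xz (count (R? x) ys) (count (λ x → R? x y) xs) _))
... | no  _ = ≡.trans (cong (count (R? x) ys +_) (pairs-∷ʳ R? xs y ys))
                      (x∙yz≈y∙xz (count (R? x) ys) (count (λ x → R? x y) xs) _)

pairs-∷-∷ : {R : A → A → Set} (R? : Binary.Decidable R) {u : A} (xs : List A) → ¬ R u u →
            pairs R? (u ∷ xs) (u ∷ xs) ≡ (count (R? u) xs + count (λ x → R? x u) xs) + pairs R? xs xs
pairs-∷-∷ R? {u} xs ¬Ruu with R? u u
... | yes Ruu = contradiction Ruu ¬Ruu
... | no  _   = ≡.trans (cong (count (R? u) xs +_) (pairs-∷ʳ R? xs u xs))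
                        (≡.sym (+-assoc (count (R? u) xs) (count (λ x → R? x u) xs) (pairs R? xs xs)))

count-cartesianProduct : {P : A × B → Set} (P? : Decidable P) (xs : List A) (ys : List B) →
                         count P? (cartesianProduct xs ys) ≡ pairs (λ x y → P? (x , y)) xs ys
count-cartesianProduct P? [] ys = refl
count-cartesianProduct P? (x ∷ xs) ys =
  ≡.trans (count-++ P? (map (x ,_) ys) (cartesianProduct xs ys))
          (cong₂ _+_ (count-map P? (x ,_) ys) (count-cartesianProduct P? xs ys))

∈⇒↭∷ : {v : A} {xs : List A} → v ∈ xs → ∃[ ys ] xs ↭ v ∷ ys
∈⇒↭∷ {v = v} v∈xs with ys , zs , refl ← ∈-∃++ v∈xs = ys ++ zs , shift v ys zs

Unique-resp-↭ : {xs ys : List A} → xs ↭ ys → Unique xs → Unique ys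
Unique-resp-↭ {A = A} p = ↭ₛ.Unique-resp-↭ (≡.setoid A) (↭⇒↭ₛ p)

extract : {x : A} {xs : List A} → Unique xs → x ∈ xs → ∃[ ys ] xs ↭ x ∷ ys × Unique ys
extract uniq x∈xs with ys , p ← ∈⇒↭∷ x∈xs = ys , p , AllPairs.tail (Unique-resp-↭ p uniq)

Unique-++⇒Disjoint : (xs : List A) {ys : List A} → Unique (xs ++ ys) → Disjoint xs ys
Unique-++⇒Disjoint (x ∷ xs) (x≢ ∷ _)    (here refl , v∈ys)  = All.lookup x≢ (∈-++⁺ʳ xs v∈ys) refl
Unique-++⇒Disjoint (x ∷ xs) (_ ∷ uniq) (there v∈xs , v∈ys) = Unique-++⇒Disjoint xs uniq (v∈xs , v∈ys)

inhabitant : {xs : List A} → 0 < length xs → ∃[ x ] x ∈ xs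
inhabitant {xs = x ∷ _} _ = x , here refl

maximiser : (g : A → ℕ) (xs : List A) → 0 < length xs →
            ∃[ x ] x ∈ xs × (∀ {y} → y ∈ xs → g y ≤ g x)
maximiser g (x ∷ xs) _ = argmax g x xs , argmax∈ , bound
  where
  argmax∈ : argmax g x xs ∈ x ∷ xs
  argmax∈ with argmax-sel g x xs
  ... | inj₁ eq  = here eq
  ... | inj₂ ∈xs = there ∈xs
  bound : ∀ {y} → y ∈ x ∷ xs → g y ≤ g (argmax g x xs)
  bound (here refl)  = f[⊥]≤f[argmax] {f = g} x xs
  bound (there y∈xs) = All.lookup (f[xs]≤f[argmax] {f = g} x xs) y∈xs

-- Tight: K₂, K₃, K₄, K₅ and the star K₁,₃ₘ₋₂ (padded with isolated vertices) have one edge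
-- more and cannot be split into M independent triples.
edgeBudget : ℕ → ℕ
edgeBudget 0 = 0
edgeBudget 1 = 0
edgeBudget 2 = 2
edgeBudget 3 = 5
edgeBudget (suc (suc (suc (suc j)))) = 9 + 3 * j

3k∸3≡edgeBudget : ∀ j → 3 * (4 + j) ∸ 3 ≡ edgeBudget (4 + j)
3k∸3≡edgeBudget j = ≡.trans (cong (_∸ 3) (3[4+j]≡3+9+3j j)) (m+n∸m≡n 3 (9 + 3 * j))
  where
  3[4+j]≡3+9+3j : ∀ j → 3 * (4 + j) ≡ 3 + (9 + 3 * j)
  3[4+j]≡3+9+3j = solve-∀

edgeBudget+3≤ : ∀ m → edgeBudget (suc m) + 3 ≤ 3 * suc m
edgeBudget+3≤ 0 = ≤-refl
edgeBudget+3≤ 1 = m≤m+n 5 1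
edgeBudget+3≤ 2 = m≤m+n 8 1
edgeBudget+3≤ (suc (suc (suc j))) = ≤-reflexive (9+3j+3≡3[4+j] j)
  where
  9+3j+3≡3[4+j] : ∀ j → 9 + 3 * j + 3 ≡ 3 * (4 + j)
  9+3j+3≡3[4+j] = solve-∀

remainder-positive : ∀ m {s t} → s ≤ edgeBudget (suc m) → 3 * suc m ≤ 2 + s + t → 0 < t
remainder-positive m {s} {t} s≤ 3M≤ = s≤s⁻¹ (s≤s⁻¹ (+-cancelˡ-≤ s 3 (2 + t) (begin
  s + 3                  ≤⟨ +-monoˡ-≤ 3 s≤ ⟩
  edgeBudget (suc m) + 3 ≤⟨ edgeBudget+3≤ m ⟩
  3 * suc m              ≤⟨ 3M≤ ⟩
  2 + s + t              ≡⟨ 2+s+t≡s+[2+t] s t ⟩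
  s + (2 + t)            ∎)))
  where
  open ≤-Reasoning
  2+s+t≡s+[2+t] : ∀ s t → 2 + s + t ≡ s + (2 + t)
  2+s+t≡s+[2+t] = solve-∀

halve : ∀ {m n} → m + m ≤ n + n → m ≤ n
halve m+m≤n+n = ≮⇒≥ (λ n<m → <⇒≱ (+-mono-< n<m n<m) m+m≤n+n)

StepBound : ℕ → ℕ → ℕ → ℕ → Set
StepBound M e Δ d =
  d ≤ Δ → Δ ≤ e → e ≤ edgeBudget M → e + e ≤ Δ + Δ * Δ + (3 * M ∸ suc Δ) * d →
  e ≤ edgeBudget (M ∸ 1) + (Δ + d)

stepBound? : ∀ M e Δ d → Dec (StepBound M e Δ d)
stepBound? M e Δ d = d ≤? Δ →-dec Δ ≤? e →-dec e ≤? edgeBudget M →-dec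
  (e + e ≤? Δ + Δ * Δ + (3 * M ∸ suc Δ) * d) →-dec e ≤? edgeBudget (M ∸ 1) + (Δ + d)

SmallStepBound : ℕ → Set
SmallStepBound M = ∀ {e} → e < N → ∀ {Δ} → Δ < N → ∀ {d} → d < N → StepBound M e Δ d
  where
  N : ℕ
  N = suc (edgeBudget M)

smallStepBound? : ∀ M → Dec (SmallStepBound M)
smallStepBound? M = allUpTo? (λ e → allUpTo? (λ Δ → allUpTo? (stepBound? M e Δ) N) N) N
  where
  N : ℕ
  N = suc (edgeBudget M)

smallStep : ∀ M {e Δ d r} → SmallStepBound M → d ≤ Δ → Δ ≤ e → e ≤ edgeBudget M →
            suc (Δ + r) ≡ 3 * M → e + e ≤ Δ + Δ * Δ + r * d → e ≤ edgeBudget (M ∸ 1) + (Δ + d)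
smallStep M {e} {Δ} {d} {r} bound d≤Δ Δ≤e e≤ len degrees =
  bound (s≤s e≤) (s≤s (≤-trans Δ≤e e≤)) (s≤s (≤-trans d≤Δ (≤-trans Δ≤e e≤))) d≤Δ Δ≤e e≤
    (subst (λ r → e + e ≤ Δ + Δ * Δ + r * d) r≡3M∸1+Δ degrees)
  where
  r≡3M∸1+Δ : r ≡ 3 * M ∸ suc Δ
  r≡3M∸1+Δ = ≡.sym (≡.trans (cong (_∸ suc Δ) (≡.sym len)) (m+n∸m≡n (suc Δ) r))

largeStep : ∀ j {e Δ d r} → d ≤ Δ → e ≤ 9 + 3 * suc j → suc (Δ + r) ≡ 3 * (5 + j) →
            e + e ≤ Δ + Δ * Δ + r * d → e ≤ 9 + 3 * j + (Δ + d)
largeStep j {e} {Δ} {d} {r} d≤Δ e≤ len degrees with 3 ≤? Δ + d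
... | yes 3≤Δ+d =
  ≤-trans e≤ (≤-trans (≤-reflexive (9+3[1+j]≡9+3j+3 j)) (+-monoʳ-≤ (9 + 3 * j) 3≤Δ+d))
  where
  9+3[1+j]≡9+3j+3 : ∀ j → 9 + 3 * suc j ≡ 9 + 3 * j + 3
  9+3[1+j]≡9+3j+3 = solve-∀
... | no 3≰Δ+d = lowDegree Δ d d≤Δ (≰⇒> 3≰Δ+d) len degrees
  where
  atMost3 : ∀ {s} → e ≤ 3 → e ≤ 9 + 3 * j + s
  atMost3 e≤3 = ≤-trans e≤3 (≤-trans (m≤m+n 3 (6 + 3 * j)) (m≤m+n _ _))
  isolatedRest : ∀ {k} → e + e ≤ k + r * 0 → e + e ≤ k
  isolatedRest {k} degrees =
    ≤-trans degrees (≤-reflexive (≡.trans (cong (k +_) (*-zeroʳ r)) (+-identityʳ k)))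
  lowDegree : ∀ Δ d → d ≤ Δ → Δ + d < 3 → suc (Δ + r) ≡ 3 * (5 + j) →
              e + e ≤ Δ + Δ * Δ + r * d → e ≤ 9 + 3 * j + (Δ + d)
  lowDegree 0 0 _ _ _ degrees = atMost3 (halve (≤-trans (isolatedRest degrees) z≤n))
  lowDegree 1 0 _ _ _ degrees = atMost3 (halve (≤-trans (isolatedRest degrees) (m≤m+n 2 4)))
  lowDegree 2 0 _ _ _ degrees = atMost3 (halve (isolatedRest degrees))
  lowDegree 1 1 _ _ len degrees = halve (begin
    e + e                             ≤⟨ degrees ⟩
    2 + r * 1                         ≡⟨ cong (2 +_) (*-identityʳ r) ⟩
    2 + r                             ≡⟨ len ⟩
    3 * (5 + j)                       ≤⟨ m≤m+n (3 * (5 + j)) (7 + 3 * j) ⟩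
    3 * (5 + j) + (7 + 3 * j)         ≡⟨ regroup j ⟩
    (9 + 3 * j + 2) + (9 + 3 * j + 2) ∎)
    where
    open ≤-Reasoning
    regroup : ∀ j → 3 * (5 + j) + (7 + 3 * j) ≡ (9 + 3 * j + 2) + (9 + 3 * j + 2)
    regroup = solve-∀
  lowDegree 0 (suc _) () _ _ _
  lowDegree 1 (suc (suc _)) (s≤s ()) _ _ _
  lowDegree 2 (suc _) _ (s≤s (s≤s (s≤s ()))) _ _
  lowDegree (suc (suc (suc _))) _ _ (s≤s (s≤s (s≤s ()))) _ _

-- For M ≤ 4 every quantity is at most edgeBudget M ≤ 9, so the inequality is decided by evaluation.
edgeBudget-step : ∀ m {e Δ d r} → d ≤ Δ → Δ ≤ e → e ≤ edgeBudget (2 + m) →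
                  suc (Δ + r) ≡ 3 * (2 + m) → e + e ≤ Δ + Δ * Δ + r * d →
                  e ≤ edgeBudget (suc m) + (Δ + d)
edgeBudget-step 0 = smallStep 2 (toWitness {a? = smallStepBound? 2} tt)
edgeBudget-step 1 = smallStep 3 (toWitness {a? = smallStepBound? 3} tt)
edgeBudget-step 2 = smallStep 4 (toWitness {a? = smallStepBound? 4} tt)
edgeBudget-step (suc (suc (suc j))) d≤Δ _ = largeStep j d≤Δ

module _ {n : ℕ} (G : Graph n) where

  open DecMembership (_≟_ {n}) using (_∈?_)

  deg : Fin n → List (Fin n) → ℕ
  deg u = count (adj? G u)

  edges : List (Fin n) → ℕ
  edges [] = 0
  edges (u ∷ us) = deg u us + edges us

  deg-∷ : ∀ {u w} us → ¬ Adj G u w → deg u (w ∷ us) ≡ deg u us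
  deg-∷ {u} {w} us ¬uw with adj? G u w
  ... | yes uw = contradiction uw ¬uw
  ... | no  _  = refl

  deg-↭ : ∀ u {us ws} → us ↭ ws → deg u us ≡ deg u ws
  deg-↭ u = count-↭ (adj? G u)

  deg-remove : ∀ {u w us ws} → us ↭ w ∷ ws → ¬ Adj G u w → deg u us ≡ deg u ws
  deg-remove {u} {ws = ws} p ¬uw = ≡.trans (deg-↭ u p) (deg-∷ ws ¬uw)

  deg-flip : ∀ u us → count (λ w → adj? G w u) us ≡ deg u us
  deg-flip u us = count-cong-∈ (λ w → adj? G w u) (adj? G u) us (λ _ → sym G) (λ _ → sym G)

  edges-swap : ∀ u w us → edges (u ∷ w ∷ us) ≡ edges (w ∷ u ∷ us)
  edges-swap u w us with adj? G u w | adj? G w u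
  ... | yes _  | yes _  = cong suc (x∙yz≈y∙xz (deg u us) (deg w us) (edges us))
  ... | no  _  | no  _  = x∙yz≈y∙xz (deg u us) (deg w us) (edges us)
  ... | yes uw | no ¬wu = contradiction (sym G uw) ¬wu
  ... | no ¬uw | yes wu = contradiction (sym G wu) ¬uw

  edges-↭ : ∀ {us ws} → us ↭ ws → edges us ≡ edges ws
  edges-↭ ↭.refl = refl
  edges-↭ (prep u p) = cong₂ _+_ (deg-↭ u p) (edges-↭ p)
  edges-↭ (swap {us} u w p) = ≡.trans (edges-swap u w us)
    (cong₂ _+_ (deg-↭ w (prep u p)) (cong₂ _+_ (deg-↭ u p) (edges-↭ p)))
  edges-↭ (↭.trans p q) = ≡.trans (edges-↭ p) (edges-↭ q)

  handshake : ∀ us → sum (map (λ w → deg w us) us) ≡ edges us + edges us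
  handshake [] = refl
  handshake (u ∷ us) = begin
    pairs (adj? G) (u ∷ us) (u ∷ us)
      ≡⟨ pairs-∷-∷ (adj? G) us (irrefl G) ⟩
    (deg u us + count (λ w → adj? G w u) us) + pairs (adj? G) us us
      ≡⟨ cong₂ _+_ (cong (deg u us +_) (deg-flip u us)) (handshake us) ⟩
    (deg u us + deg u us) + (edges us + edges us)
      ≡⟨ interchange (deg u us) (deg u us) (edges us) (edges us) ⟩
    (deg u us + edges us) + (deg u us + edges us)
      ∎
    where open ≡.≡-Reasoning

  Forward : Fin n → Fin n → Set
  Forward u w = toℕ u < toℕ w × Adj G u w

  forward? : ∀ u w → Dec (Forward u w)
  forward? u w = (toℕ u <? toℕ w) ×-dec adj? G u w

  deg≡forward+backward : ∀ u us → deg u us ≡ count (forward? u) us + count (λ w → forward? w u) us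
  deg≡forward+backward u us = ≡.trans (count≡count∩+count∁∩ (adj? G u) (λ w → toℕ u <? toℕ w) us)
    (cong (count (forward? u) us +_)
          (count-cong-∈ _ (λ w → forward? w u) us (λ _ → flip) (λ _ → unflip)))
    where
    flip : ∀ {w} → ¬ toℕ u < toℕ w × Adj G u w → Forward w u
    flip (u≮w , uw) = ≤∧≢⇒< (≮⇒≥ u≮w) (λ w≡u → irrefl G (subst (Adj G u) (toℕ-injective w≡u) uw)) ,
                      sym G uw
    unflip : ∀ {w} → Forward w u → ¬ toℕ u < toℕ w × Adj G u w
    unflip (w<u , wu) = (λ u<w → <-asym u<w w<u) , sym G wu

  pairs-forward : ∀ us → pairs forward? us us ≡ edges us
  pairs-forward [] = refl
  pairs-forward (u ∷ us) = ≡.trans (pairs-∷-∷ forward? us (λ (u<u , _) → <-irrefl refl u<u))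
    (cong₂ _+_ (≡.sym (deg≡forward+backward u us)) (pairs-forward us))

  edgeCount≡edges : edgeCount G ≡ edges (allFin n)
  edgeCount≡edges = ≡.trans (count-cartesianProduct _ (allFin n) (allFin n)) (pairs-forward (allFin n))

  TriplePartition : ℕ → List (Fin n) → Set
  TriplePartition k us = Σ[ c ∈ (Fin n → Fin k) ]
    (∀ a → count (λ u → c u ≟ a) us ≡ 3) × (∀ {u w} → u ∈ us → w ∈ us → Adj G u w → c u ≢ c w)

  triplePartition-↭ : ∀ {k us ws} → us ↭ ws → TriplePartition k ws → TriplePartition k us
  triplePartition-↭ p (c , sizes , proper) =
    c , (λ a → ≡.trans (count-↭ _ p) (sizes a)) , λ u∈ w∈ → proper (∈-resp-↭ p u∈) (∈-resp-↭ p w∈)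

  Independent : List (Fin n) → Set
  Independent = AllPairs (λ u w → ¬ Adj G u w)

  independent-∈ : ∀ {ts u w} → Independent ts → u ∈ ts → w ∈ ts → ¬ Adj G u w
  independent-∈ (_ ∷ _)    (here refl) (here refl) = irrefl G
  independent-∈ (¬adj ∷ _) (here refl) (there w∈)    = All.lookup ¬adj w∈
  independent-∈ (¬adj ∷ _) (there u∈)    (here refl) = All.lookup ¬adj u∈ ∘ sym G
  independent-∈ (_ ∷ ind)  (there u∈)    (there w∈)    = independent-∈ ind u∈ w∈

  triplePartition-++ : ∀ {k ts us} → Independent ts → length ts ≡ 3 → Disjoint ts us →
                       TriplePartition k us → TriplePartition (suc k) (ts ++ us)
  triplePartition-++ {k} {ts} {us} ind |ts| disj (c , sizes , proper) = colour , sizes′ , proper′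
    where
    colour : Fin n → Fin (suc k)
    colour u with u ∈? ts
    ... | yes _ = Fin.zero
    ... | no  _ = Fin.suc (c u)

    colour-ts : ∀ {u} → u ∈ ts → colour u ≡ Fin.zero
    colour-ts {u} u∈ with u ∈? ts
    ... | yes _  = refl
    ... | no u∉ = contradiction u∈ u∉

    colour-us : ∀ {u} → u ∈ us → colour u ≡ Fin.suc (c u)
    colour-us {u} u∈us with u ∈? ts
    ... | yes u∈ = contradiction (u∈ , u∈us) disj
    ... | no  _  = refl

    sizes′ : ∀ a → count (λ u → colour u ≟ a) (ts ++ us) ≡ 3
    sizes′ Fin.zero = begin
      count (λ u → colour u ≟ Fin.zero) (ts ++ us)   ≡⟨ count-++ _ ts us ⟩
      count (λ u → colour u ≟ Fin.zero) ts + count (λ u → colour u ≟ Fin.zero) us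
        ≡⟨ cong₂ _+_ (count-all _ ts colour-ts)
                     (count-none _ us λ u∈ eq → 0≢1+n (≡.trans (≡.sym eq) (colour-us u∈))) ⟩
      length ts + 0                                   ≡⟨ +-identityʳ (length ts) ⟩
      length ts                                       ≡⟨ |ts| ⟩
      3                                               ∎
      where open ≡.≡-Reasoning
    sizes′ (Fin.suc a) = begin
      count (λ u → colour u ≟ Fin.suc a) (ts ++ us)  ≡⟨ count-++ _ ts us ⟩
      count (λ u → colour u ≟ Fin.suc a) ts + count (λ u → colour u ≟ Fin.suc a) us
        ≡⟨ cong₂ _+_ (count-none _ ts λ u∈ eq → 0≢1+n (≡.trans (≡.sym (colour-ts u∈)) eq))
                     (count-cong-∈ _ (λ u → c u ≟ a) us
                       (λ u∈ eq → suc-injective (≡.trans (≡.sym (colour-us u∈)) eq))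
                       (λ u∈ eq → ≡.trans (colour-us u∈) (cong Fin.suc eq))) ⟩
      0 + count (λ u → c u ≟ a) us                    ≡⟨ sizes a ⟩
      3                                               ∎
      where open ≡.≡-Reasoning

    proper′ : ∀ {u w} → u ∈ ts ++ us → w ∈ ts ++ us → Adj G u w → colour u ≢ colour w
    proper′ {u} {w} u∈ w∈ uw with ∈-++⁻ ts u∈ | ∈-++⁻ ts w∈
    ... | inj₁ u∈ts | inj₁ w∈ts = contradiction uw (independent-∈ ind u∈ts w∈ts)
    ... | inj₁ u∈ts | inj₂ w∈us = λ eq →
      0≢1+n (≡.trans (≡.sym (colour-ts u∈ts)) (≡.trans eq (colour-us w∈us)))
    ... | inj₂ u∈us | inj₁ w∈ts = λ eq →
      0≢1+n (≡.trans (≡.sym (colour-ts w∈ts)) (≡.trans (≡.sym eq) (colour-us u∈us)))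
    ... | inj₂ u∈us | inj₂ w∈us = λ eq →
      proper u∈us w∈us uw (suc-injective (≡.trans (≡.sym (colour-us u∈us)) (≡.trans eq (colour-us w∈us))))

  deg≤edges : ∀ {u us} → u ∈ us → deg u us ≤ edges us
  deg≤edges {u} {us} u∈ with ws , p ← ∈⇒↭∷ u∈ = begin
    deg u us          ≡⟨ deg-remove p (irrefl G) ⟩
    deg u ws          ≤⟨ m≤m+n (deg u ws) (edges ws) ⟩
    edges (u ∷ ws)    ≡⟨ ≡.sym (edges-↭ p) ⟩
    edges us          ∎
    where open ≤-Reasoning

  nonNbr? : ∀ u → Decidable (∁ (Adj G u))
  nonNbr? u = ∁? (adj? G u)

  -- Vertex sets are duplicate-free lists; the triple {v, x, y} is split off along permutations
  -- us ↭ v ∷ us₁, us₁ ↭ x ∷ us₂ and us₂ ↭ y ∷ us₃, under which degrees and edge counts are invariant.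
  module Step (m : ℕ) {us : List (Fin n)} (uniq : Unique us) (len : length us ≡ 3 * (2 + m))
              (e≤ : edges us ≤ edgeBudget (2 + m)) where

    vMax : ∃[ v ] v ∈ us × (∀ {u} → u ∈ us → deg u us ≤ deg v us)
    vMax = maximiser (λ u → deg u us) us (subst (0 <_) (≡.sym len) (s≤s z≤n))

    v : Fin n
    v = proj₁ vMax

    Δ : ℕ
    Δ = deg v us

    deg≤Δ : ∀ {u} → u ∈ us → deg u us ≤ Δ
    deg≤Δ = proj₂ (proj₂ vMax)

    withoutV : ∃[ ws ] us ↭ v ∷ ws × Unique ws
    withoutV = extract uniq (proj₁ (proj₂ vMax))

    us₁ : List (Fin n)
    us₁ = proj₁ withoutV

    us↭v∷us₁ : us ↭ v ∷ us₁
    us↭v∷us₁ = proj₁ (proj₂ withoutV)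

    Δ≡deg-v-us₁ : Δ ≡ deg v us₁
    Δ≡deg-v-us₁ = deg-remove us↭v∷us₁ (irrefl G)

    R : List (Fin n)
    R = filter (nonNbr? v) us₁

    r : ℕ
    r = length R

    1+Δ+r≡3M : suc (Δ + r) ≡ 3 * (2 + m)
    1+Δ+r≡3M = begin
      suc (Δ + r)                                    ≡⟨ cong (λ k → suc (k + r)) Δ≡deg-v-us₁ ⟩
      suc (deg v us₁ + count (nonNbr? v) us₁)        ≡⟨ cong suc (≡.sym (length≡count+count∁ (adj? G v) us₁)) ⟩
      length (v ∷ us₁)                               ≡⟨ ≡.sym (↭-length us↭v∷us₁) ⟩
      length us                                      ≡⟨ len ⟩
      3 * (2 + m)                                    ∎
      where open ≡.≡-Reasoning

    edges≡Δ+edges-us₁ : edges us ≡ Δ + edges us₁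
    edges≡Δ+edges-us₁ = ≡.trans (edges-↭ us↭v∷us₁) (cong (_+ edges us₁) (≡.sym Δ≡deg-v-us₁))

    Δ≤edges : Δ ≤ edges us
    Δ≤edges = subst (Δ ≤_) (≡.sym edges≡Δ+edges-us₁) (m≤m+n Δ (edges us₁))

    xMax : ∃[ x ] x ∈ R × (∀ {u} → u ∈ R → deg u us ≤ deg x us)
    xMax = maximiser (λ u → deg u us) R (remainder-positive (suc m) (≤-trans Δ≤edges e≤)
      (≤-trans (≤-reflexive (≡.sym 1+Δ+r≡3M)) (n≤1+n _)))

    x : Fin n
    x = proj₁ xMax

    d : ℕ
    d = deg x us

    deg≤d : ∀ {u} → u ∈ R → deg u us ≤ d
    deg≤d = proj₂ (proj₂ xMax)

    x∈us₁ : x ∈ us₁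
    x∈us₁ = proj₁ (∈-filter⁻ (nonNbr? v) {xs = us₁} (proj₁ (proj₂ xMax)))

    v≁x : ¬ Adj G v x
    v≁x = proj₂ (∈-filter⁻ (nonNbr? v) {xs = us₁} (proj₁ (proj₂ xMax)))

    d≤Δ : d ≤ Δ
    d≤Δ = deg≤Δ (∈-resp-↭ (↭-sym us↭v∷us₁) (there x∈us₁))

    withoutX : ∃[ ws ] us₁ ↭ x ∷ ws × Unique ws
    withoutX = extract (proj₂ (proj₂ withoutV)) x∈us₁

    us₂ : List (Fin n)
    us₂ = proj₁ withoutX

    us₁↭x∷us₂ : us₁ ↭ x ∷ us₂
    us₁↭x∷us₂ = proj₁ (proj₂ withoutX)

    Δ≡deg-v-us₂ : Δ ≡ deg v us₂
    Δ≡deg-v-us₂ = ≡.trans Δ≡deg-v-us₁ (deg-remove us₁↭x∷us₂ v≁x)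

    d≡deg-x-us₂ : d ≡ deg x us₂
    d≡deg-x-us₂ = ≡.trans (deg-remove us↭v∷us₁ (v≁x ∘ sym G)) (deg-remove us₁↭x∷us₂ (irrefl G))

    edges≡Δ+d+edges-us₂ : edges us ≡ Δ + (d + edges us₂)
    edges≡Δ+d+edges-us₂ = ≡.trans edges≡Δ+edges-us₁
      (cong (Δ +_) (≡.trans (edges-↭ us₁↭x∷us₂) (cong (_+ edges us₂) (≡.sym d≡deg-x-us₂))))

    Δ+d≤edges : Δ + d ≤ edges us
    Δ+d≤edges = subst (Δ + d ≤_) (≡.sym edges≡Δ+d+edges-us₂) (+-monoʳ-≤ Δ (m≤m+n d (edges us₂)))

    R₂ : List (Fin n)
    R₂ = filter (nonNbr? x) (filter (nonNbr? v) us₂)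

    3M≤2+Δ+d+|R₂| : 3 * (2 + m) ≤ 2 + (Δ + d) + length R₂
    3M≤2+Δ+d+|R₂| = begin
      3 * (2 + m)
        ≡⟨ ≡.trans (≡.sym len) (↭-length (↭-trans us↭v∷us₁ (prep v us₁↭x∷us₂))) ⟩
      2 + length us₂
        ≡⟨ cong (2 +_) (length≡count+count∁ (adj? G v) us₂) ⟩
      2 + (deg v us₂ + length (filter (nonNbr? v) us₂))
        ≡⟨ cong (λ k → 2 + (deg v us₂ + k)) (length≡count+count∁ (adj? G x) (filter (nonNbr? v) us₂)) ⟩
      2 + (deg v us₂ + (count (adj? G x) (filter (nonNbr? v) us₂) + length R₂))
        ≤⟨ +-monoʳ-≤ 2 (+-monoʳ-≤ (deg v us₂)
             (+-monoˡ-≤ (length R₂) (count-filter-≤ (adj? G x) (nonNbr? v) us₂))) ⟩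
      2 + (deg v us₂ + (deg x us₂ + length R₂))
        ≡⟨ cong₂ (λ a b → 2 + (a + (b + length R₂))) (≡.sym Δ≡deg-v-us₂) (≡.sym d≡deg-x-us₂) ⟩
      2 + (Δ + (d + length R₂))
        ≡⟨ cong (2 +_) (≡.sym (+-assoc Δ d (length R₂))) ⟩
      2 + (Δ + d) + length R₂
        ∎
      where open ≤-Reasoning

    yPick : ∃[ y ] y ∈ R₂
    yPick = inhabitant (remainder-positive (suc m) (≤-trans Δ+d≤edges e≤) 3M≤2+Δ+d+|R₂|)

    y : Fin n
    y = proj₁ yPick

    y∈nonNbr-v : y ∈ filter (nonNbr? v) us₂
    y∈nonNbr-v = proj₁ (∈-filter⁻ (nonNbr? x) {xs = filter (nonNbr? v) us₂} (proj₂ yPick))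

    y∈us₂ : y ∈ us₂
    y∈us₂ = proj₁ (∈-filter⁻ (nonNbr? v) {xs = us₂} y∈nonNbr-v)

    v≁y : ¬ Adj G v y
    v≁y = proj₂ (∈-filter⁻ (nonNbr? v) {xs = us₂} y∈nonNbr-v)

    x≁y : ¬ Adj G x y
    x≁y = proj₂ (∈-filter⁻ (nonNbr? x) {xs = filter (nonNbr? v) us₂} (proj₂ yPick))

    withoutY : ∃[ ws ] us₂ ↭ y ∷ ws × Unique ws
    withoutY = extract (proj₂ (proj₂ withoutX)) y∈us₂

    us₃ : List (Fin n)
    us₃ = proj₁ withoutY

    us₂↭y∷us₃ : us₂ ↭ y ∷ us₃
    us₂↭y∷us₃ = proj₁ (proj₂ withoutY)

    triple : List (Fin n)
    triple = v ∷ x ∷ y ∷ []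

    us↭triple++us₃ : us ↭ triple ++ us₃
    us↭triple++us₃ = ↭-trans us↭v∷us₁ (prep v (↭-trans us₁↭x∷us₂ (prep x us₂↭y∷us₃)))

    triple-independent : Independent triple
    triple-independent = (v≁x ∷ v≁y ∷ []) ∷ (x≁y ∷ []) ∷ [] ∷ []

    triple-disjoint : Disjoint triple us₃
    triple-disjoint = Unique-++⇒Disjoint triple (Unique-resp-↭ us↭triple++us₃ uniq)

    |us₃| : length us₃ ≡ 3 * suc m
    |us₃| = +-cancelˡ-≡ 3 (length us₃) (3 * suc m)
      (≡.trans (≡.sym (↭-length us↭triple++us₃)) (≡.trans len (*-suc 3 (suc m))))

    edges-us₃+Δ+d≤edges : edges us₃ + (Δ + d) ≤ edges us
    edges-us₃+Δ+d≤edges = begin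
      edges us₃ + (Δ + d)          ≡⟨ +-comm (edges us₃) (Δ + d) ⟩
      Δ + d + edges us₃            ≤⟨ +-monoʳ-≤ (Δ + d) (m≤n+m (edges us₃) (deg y us₃)) ⟩
      Δ + d + edges (y ∷ us₃)      ≡⟨ +-assoc Δ d _ ⟩
      Δ + (d + edges (y ∷ us₃))    ≡⟨ cong (λ k → Δ + (d + k)) (≡.sym (edges-↭ us₂↭y∷us₃)) ⟩
      Δ + (d + edges us₂)          ≡⟨ ≡.sym edges≡Δ+d+edges-us₂ ⟩
      edges us                     ∎
      where open ≤-Reasoning

    degreeSum≤ : edges us + edges us ≤ Δ + Δ * Δ + r * d
    degreeSum≤ = begin
      edges us + edges us
        ≡⟨ ≡.sym (handshake us) ⟩
      sum (map deg-us us)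
        ≡⟨ sum-map-↭ deg-us us↭v∷us₁ ⟩
      Δ + sum (map deg-us us₁)
        ≡⟨ cong (Δ +_) (sum-map-filter (adj? G v) deg-us us₁) ⟩
      Δ + (sum (map deg-us (filter (adj? G v) us₁)) + sum (map deg-us R))
        ≤⟨ +-monoʳ-≤ Δ (+-mono-≤ (sum-map-≤ deg-us (filter (adj? G v) us₁) deg≤Δ-nbr)
                                 (sum-map-≤ deg-us R deg≤d)) ⟩
      Δ + (deg v us₁ * Δ + r * d)
        ≡⟨ cong (λ k → Δ + (k * Δ + r * d)) (≡.sym Δ≡deg-v-us₁) ⟩
      Δ + (Δ * Δ + r * d)
        ≡⟨ ≡.sym (+-assoc Δ (Δ * Δ) (r * d)) ⟩
      Δ + Δ * Δ + r * d
        ∎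
      where
      open ≤-Reasoning
      deg-us : Fin n → ℕ
      deg-us u = deg u us
      deg≤Δ-nbr : ∀ {u} → u ∈ filter (adj? G v) us₁ → deg u us ≤ Δ
      deg≤Δ-nbr u∈ = deg≤Δ (∈-resp-↭ (↭-sym us↭v∷us₁)
                                      (there (proj₁ (∈-filter⁻ (adj? G v) {xs = us₁} u∈))))

    edges-us₃≤ : edges us₃ ≤ edgeBudget (suc m)
    edges-us₃≤ = +-cancelʳ-≤ (Δ + d) (edges us₃) (edgeBudget (suc m)) (≤-trans edges-us₃+Δ+d≤edges
      (edgeBudget-step m d≤Δ Δ≤edges e≤ 1+Δ+r≡3M degreeSum≤))

    triplePartition : (∀ {ws} → Unique ws → length ws ≡ 3 * suc m → edges ws ≤ edgeBudget (suc m) →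
                       TriplePartition (suc m) ws) →
                      TriplePartition (2 + m) us
    triplePartition partition-us₃ = triplePartition-↭ us↭triple++us₃
      (triplePartition-++ triple-independent refl triple-disjoint
        (partition-us₃ (proj₂ (proj₂ withoutY)) |us₃| edges-us₃≤))

  partition : ∀ m {us} → Unique us → length us ≡ 3 * suc m → edges us ≤ edgeBudget (suc m) →
              TriplePartition (suc m) us
  partition 0 {us} _ len e≤0 = (λ _ → Fin.zero) , sizes , proper
    where
    sizes : ∀ a → count (λ _ → Fin.zero ≟ a) us ≡ 3
    sizes Fin.zero = ≡.trans (count-all _ us (λ _ → refl)) len
    proper : ∀ {u w} → u ∈ us → w ∈ us → Adj G u w → Fin.zero ≢ Fin.zero
    proper {u} u∈ w∈ uw _ =
      <⇒≱ (≤-trans (filter-some (adj? G u) (Any.map (λ { refl → uw }) w∈)) (deg≤edges u∈)) e≤0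
  partition (suc m) uniq len e≤ = Step.triplePartition m uniq len e≤ (partition m)

  triplePartition-allFin : ∀ {k} → TriplePartition k (allFin n) → PartitionIntoIndependentTriples G k
  triplePartition-allFin (c , sizes , proper) = c , sizes , λ u w → proper (∈-allFin u) (∈-allFin w)

lemma2p2 : (k : ℕ) → 4 ≤ k → (G : Graph (3 * k)) →
    edgeCount G ≤ 3 * k ∸ 3 → PartitionIntoIndependentTriples G k
lemma2p2 _ (s≤s (s≤s (s≤s (s≤s {n = j} _)))) G e≤
  = triplePartition-allFin G (partition G (3 + j) (allFin⁺ _) (length-tabulate id) e≤budget)
  where
  e≤budget : edges G (allFin (3 * (4 + j))) ≤ edgeBudget (4 + j)
  e≤budget = subst (_≤ _) (edgeCount≡edges G) (subst (edgeCount G ≤_) (3k∸3≡edgeBudget j) e≤)
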